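{- For every $k\ge 5$ there is $t_0(k)$ such that for all $t\ge t_0(k)$, $R^k(BK_t,BK_t)=t$. For $k=5$, $t_0=23$ suffices.
   Context: For a graph $G=(V,E)$ and an integer $r\ge 2$, $BG$ (the set of Berge copies of $G$) is the set of $r$-uniform hypergraphs $\mathcal{H}'$ for which there exist an injection $\phi: V\to V(\mathcal{H}')$ and a bijection $\psi: E\to E(\mathcal{H}')$ such that $\{\phi(u),\phi(v)\}\subseteq \psi(uv)$ for every edge $uv\in E$. $K_n$ denotes the complete graph on $n$ vertices. For collections $\mathcal{F}_1,\mathcal{F}_2$ of $r$-uniform hypergraphs, $R^r(\mathcal{F}_1,\mathcal{F}_2)$ is the least $N$ such that every 2-coloring of the hyperedges of the complete $r$-uniform hypergraph on $N$ vertices contains a subhypergraph of the first color isomorphic to a member of $\mathcal{F}_1$ or one of the second color isomorphic to a member of $\mathcal{F}_2$. Here $r=k$. -}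

module Defs where

open import Data.Nat using (ℕ; _<_)
open import Data.Fin using (Fin) renaming (_<_ to _<ᶠ_)
open import Data.Fin.Subset using (Subset; _∈_; ∣_∣)
open import Data.Bool using (Bool; true; false)
open import Data.Product using (Σ; _×_; ∃)
open import Data.Sum using (_⊎_)
open import Function.Definitions using (Injective)
open import Relation.Binary.PropositionalEquality using (_≡_)
open import Relation.Nullary using (¬_)

-- We colour every subset of Fin N; only the values on
-- k-element subsets (the hyperedges) are ever used.
Colouring : ℕ → Set
Colouring N = Subset N → Bool

-- Berge copy of K_t inside the colour class `col` of colouring c of K_N^(k):
-- an injection φ : Fin t → Fin N and an injective assignment ψ of a
-- hyperedge (k-subset) of colour `col` to each edge {u,v} (u < v) of K_t,
-- such that φ u, φ v ∈ ψ(uv).  (The subhypergraph is the image of ψ, so ψ is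
-- a bijection onto its edge set.)
BergeKt : (k t N : ℕ) → Colouring N → Bool → Set
BergeKt k t N c col =
  Σ (Fin t → Fin N) λ φ →
  Injective _≡_ _≡_ φ ×
  Σ ((u v : Fin t) → u <ᶠ v → Subset N) λ ψ →
    (∀ u v (p : u <ᶠ v) →
        ∣ ψ u v p ∣ ≡ k × c (ψ u v p) ≡ col × φ u ∈ ψ u v p × φ v ∈ ψ u v p)
    × (∀ u v (p : u <ᶠ v) u' v' (p' : u' <ᶠ v') →
        ψ u v p ≡ ψ u' v' p' → (u ≡ u' × v ≡ v'))

RamseyArrows : (k t N : ℕ) → Set
RamseyArrows k t N = (c : Colouring N) → BergeKt k t N c true ⊎ BergeKt k t N c false

RamseyBergeEq : (k t N : ℕ) → Set
RamseyBergeEq k t N = RamseyArrows k t N × (∀ M → M < N → ¬ RamseyArrows k t M)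

module Submission where

-- For N = t a Berge K_t must use all vertices, so a colour class contains one
-- exactly when the bipartite graph joining each pair of [t] to the k-edges of
-- that colour containing it has a matching saturating the pairs.  If this fails
-- in both colours, Hall's theorem gives sets S, T of pairs with |N_red(S)| < |S|
-- and |N_blue(T)| < |T|; say |T| ≤ |S| and pick e₀ ∈ T.  Every k-edge through
-- e₀ containing a pair of S is a red neighbour of S or a blue neighbour of T,
-- so there are fewer than 2|S| of them.  Yet double counting incidences between
-- S and such edges gives at least 2|S| of them once C(t−4, k−4) ≥ 2(C(k,2) − 1)
-- and C(t−2, k−2) ≥ 2 C(t,2), which hold for t ≥ 23 when k = 5 and for
-- t ≥ k² + k + 20 in general.

open import Defs
open import Data.Nat using (ℕ; _≥_)
open import Data.Product using (Σ; _×_)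

open import Data.Bool using (Bool; true; false; _∧_; _∨_; not; if_then_else_; T)
open import Data.Bool.ListAction using (any)
open import Data.Bool.Properties using (∧-zeroʳ; T-≡)
open import Data.Empty using (⊥; ⊥-elim)
open import Data.Fin using (Fin; zero; suc) renaming (_<_ to _<ᶠ_)
open import Data.Fin.Properties using (<⇒notInjective) renaming (<⇒≢ to <ᶠ⇒≢; <-irrefl to <ᶠ-irrefl; <-trans to <ᶠ-trans)
open import Data.Fin.Subset using (Subset; ∣_∣; _∪_; _⊆_; _∈_; ⁅_⁆) renaming (⊥ to ∅)
open import Data.Fin.Subset.Properties using (∣p∣≤n; p⊆q⇒∣p∣≤∣q∣; ∣⊥∣≡0; ∣⁅x⁆∣≡1; ∪-identityˡ; ∪-identityʳ; x∈⁅x⁆; x∈⁅y⁆⇒x≡y; x∈p∪q⁺; x∈p∪q⁻)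
open import Data.List using (List; []; _∷_; _++_; map)
open import Data.List.Properties using (map-++; map-∘)
open import Data.List.Membership.Propositional using (lose) renaming (_∈_ to _∈ˡ_)
open import Data.List.Membership.Propositional.Properties using (∈-map⁺; ∈-++⁺ˡ; ∈-++⁺ʳ)
open import Data.List.Relation.Unary.Any using (here; there; any?; satisfied)
open import Data.Nat
open import Data.Nat.Combinatorics using (_C_; nC1≡n; nCk+nC[k+1]≡[n+1]C[k+1])
open import Data.Nat.ListAction using (sum)
open import Data.Nat.ListAction.Properties using (sum-++)
open import Data.Nat.Properties
open import Algebra.Properties.CommutativeSemigroup +-commutativeSemigroup using (interchange)
open import Data.Nat.Tactic.RingSolver using (solve-∀)
open import Data.Product using (_,_; proj₁; proj₂)
open import Data.Sum using (_⊎_; inj₁; inj₂)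
open import Data.Unit using (tt)
open import Data.Vec using ([]; _∷_; here; there)
open import Function using (_∘_; Equivalence)
open import Relation.Binary.PropositionalEquality
open import Relation.Nullary using (¬_; Dec; yes; no)
open import Relation.Nullary.Decidable using (_×-dec_)

private
  variable
    A B : Set

∧-elimˡ : ∀ {a b} → a ∧ b ≡ true → a ≡ true
∧-elimˡ {true} _ = refl

∧-elimʳ : ∀ {a b} → a ∧ b ≡ true → b ≡ true
∧-elimʳ {true} b≡true = b≡true

∧-intro : ∀ {a b} → a ≡ true → b ≡ true → a ∧ b ≡ true
∧-intro refl refl = refl

∨-introˡ : ∀ {a b} → a ≡ true → a ∨ b ≡ true
∨-introˡ refl = refl

∨-introʳ : ∀ {a b} → b ≡ true → a ∨ b ≡ true
∨-introʳ {true} _ = refl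
∨-introʳ {false} b≡true = b≡true

∨-elim : ∀ {a b} → a ∨ b ≡ true → a ≡ true ⊎ b ≡ true
∨-elim {true} _ = inj₁ refl
∨-elim {false} b≡true = inj₂ b≡true

not-intro : ∀ {a} → a ≡ false → not a ≡ true
not-intro refl = refl

not-elim : ∀ {a} → not a ≡ true → a ≡ false
not-elim {false} _ = refl

≡true⇒≢false : ∀ {a} → a ≡ true → a ≡ false → ⊥
≡true⇒≢false refl ()

boolToℕ : Bool → ℕ
boolToℕ true = 1
boolToℕ false = 0

∑ : List A → (A → ℕ) → ℕ
∑ xs f = sum (map f xs)

count : List A → (A → Bool) → ℕ
count xs P = ∑ xs (boolToℕ ∘ P)

∑-mono-≤ : ∀ xs (f g : A → ℕ) → (∀ x → f x ≤ g x) → ∑ xs f ≤ ∑ xs g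
∑-mono-≤ [] f g f≤g = z≤n
∑-mono-≤ (x ∷ xs) f g f≤g = +-mono-≤ (f≤g x) (∑-mono-≤ xs f g f≤g)

∑-cong : ∀ xs (f g : A → ℕ) → (∀ x → f x ≡ g x) → ∑ xs f ≡ ∑ xs g
∑-cong [] f g f≡g = refl
∑-cong (x ∷ xs) f g f≡g = cong₂ _+_ (f≡g x) (∑-cong xs f g f≡g)

∑-distrib-+ : ∀ xs (f g : A → ℕ) → ∑ xs (λ x → f x + g x) ≡ ∑ xs f + ∑ xs g
∑-distrib-+ [] f g = refl
∑-distrib-+ (x ∷ xs) f g = trans (cong (f x + g x +_) (∑-distrib-+ xs f g)) (interchange (f x) (g x) (∑ xs f) (∑ xs g))

∑-*ʳ : ∀ xs (f : A → ℕ) c → ∑ xs (λ x → f x * c) ≡ ∑ xs f * c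
∑-*ʳ [] f c = refl
∑-*ʳ (x ∷ xs) f c = trans (cong (f x * c +_) (∑-*ʳ xs f c)) (sym (*-distribʳ-+ c (f x) (∑ xs f)))

∑-++ : ∀ xs ys (f : A → ℕ) → ∑ (xs ++ ys) f ≡ ∑ xs f + ∑ ys f
∑-++ xs ys f = trans (cong sum (map-++ f xs ys)) (sum-++ (map f xs) (map f ys))

∑-zero : ∀ xs → ∑ {A} xs (λ _ → 0) ≡ 0
∑-zero [] = refl
∑-zero (x ∷ xs) = ∑-zero xs

count-mono : ∀ xs (P Q : A → Bool) → (∀ x → P x ≡ true → Q x ≡ true) → count xs P ≤ count xs Q
count-mono xs P Q P⊆Q = ∑-mono-≤ xs _ _ λ x → pointwise x (P x) refl
  where
  pointwise : ∀ x b → P x ≡ b → boolToℕ (P x) ≤ boolToℕ (Q x)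
  pointwise x true Px rewrite Px | P⊆Q x Px = ≤-refl
  pointwise x false Px rewrite Px = z≤n

count-cong : ∀ xs (P Q : A → Bool) → (∀ x → P x ≡ Q x) → count xs P ≡ count xs Q
count-cong xs P Q P≡Q = ∑-cong xs _ _ λ x → cong boolToℕ (P≡Q x)

count-false : ∀ xs (P : A → Bool) → (∀ x → P x ≡ false) → count xs P ≡ 0
count-false xs P P≡false = trans (count-cong xs P (λ _ → false) P≡false) (∑-zero xs)

count-pos : ∀ xs (P : A → Bool) x → x ∈ˡ xs → P x ≡ true → 1 ≤ count xs P
count-pos (y ∷ xs) P x (here refl) Px rewrite Px = s≤s z≤n
count-pos (y ∷ xs) P x (there x∈xs) Px = ≤-trans (count-pos xs P x x∈xs Px) (m≤n+m _ _)

count-witness : ∀ xs (P : A → Bool) → 1 ≤ count xs P → Σ A λ x → x ∈ˡ xs × P x ≡ true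
count-witness (y ∷ xs) P pos with P y in Py
... | true = y , here refl , Py
... | false = let (x , x∈xs , Px) = count-witness xs P pos in x , there x∈xs , Px

count≡0⇒false : ∀ xs (P : A → Bool) → count xs P ≡ 0 → ∀ x → x ∈ˡ xs → P x ≡ false
count≡0⇒false xs P count≡0 x x∈xs with P x in Px
... | false = refl
... | true with () ← ≤-trans (count-pos xs P x x∈xs Px) (≤-reflexive count≡0)

count-split : ∀ xs (P Q : A → Bool) → count xs P ≡ count xs (λ x → P x ∧ Q x) + count xs (λ x → P x ∧ not (Q x))
count-split xs P Q = trans (∑-cong xs _ _ λ x → pointwise (P x) (Q x)) (∑-distrib-+ xs _ _)
  where
  pointwise : ∀ p q → boolToℕ p ≡ boolToℕ (p ∧ q) + boolToℕ (p ∧ not q)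
  pointwise true true = refl
  pointwise true false = refl
  pointwise false q = refl

count-∨ : ∀ xs (P Q : A → Bool) → count xs (λ x → P x ∨ Q x) ≤ count xs P + count xs Q
count-∨ xs P Q = ≤-trans (∑-mono-≤ xs _ _ λ x → pointwise (P x) (Q x)) (≤-reflexive (∑-distrib-+ xs _ _))
  where
  pointwise : ∀ p q → boolToℕ (p ∨ q) ≤ boolToℕ p + boolToℕ q
  pointwise true q = s≤s z≤n
  pointwise false q = ≤-refl

count-∨-disjoint : ∀ xs (P Q : A → Bool) → (∀ x → P x ≡ true → Q x ≡ false) →
                   count xs (λ x → P x ∨ Q x) ≡ count xs P + count xs Q
count-∨-disjoint xs P Q disjoint = trans (∑-cong xs _ _ λ x → pointwise x (P x) refl) (∑-distrib-+ xs _ _)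
  where
  pointwise : ∀ x p → P x ≡ p → boolToℕ (p ∨ Q x) ≡ boolToℕ p + boolToℕ (Q x)
  pointwise x true Px rewrite disjoint x Px = refl
  pointwise x false Px = refl

count*≤∑ : ∀ xs (P : A → Bool) (f : A → ℕ) c → (∀ x → P x ≡ true → c ≤ f x) → count xs P * c ≤ ∑ xs f
count*≤∑ xs P f c bound = ≤-trans (≤-reflexive (sym (∑-*ʳ xs _ c))) (∑-mono-≤ xs _ _ λ x → pointwise x (P x) refl)
  where
  pointwise : ∀ x p → P x ≡ p → boolToℕ p * c ≤ f x
  pointwise x true Px = ≤-trans (≤-reflexive (+-identityʳ c)) (bound x Px)
  pointwise x false Px = z≤n

∑≤count* : ∀ xs (P : A → Bool) (f : A → ℕ) c → (∀ x → f x ≤ boolToℕ (P x) * c) → ∑ xs f ≤ count xs P * c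
∑≤count* xs P f c bound = ≤-trans (∑-mono-≤ xs _ _ bound) (≤-reflexive (∑-*ʳ xs _ c))

any-intro : ∀ xs (P : A → Bool) x → x ∈ˡ xs → P x ≡ true → any P xs ≡ true
any-intro (y ∷ xs) P x (here refl) Px = ∨-introˡ Px
any-intro (y ∷ xs) P x (there x∈xs) Px = ∨-introʳ (any-intro xs P x x∈xs Px)

any-witness : ∀ xs (P : A → Bool) → any P xs ≡ true → Σ A λ x → P x ≡ true
any-witness (y ∷ xs) P anyP with ∨-elim {P y} anyP
... | inj₁ Py = y , Py
... | inj₂ anyP′ = any-witness xs P anyP′

any-mono : ∀ xs (P Q : A → Bool) → (∀ x → P x ≡ true → Q x ≡ true) → any P xs ≡ true → any Q xs ≡ true
any-mono (y ∷ xs) P Q P⊆Q anyP with ∨-elim {P y} anyP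
... | inj₁ Py = ∨-introˡ (P⊆Q y Py)
... | inj₂ anyP′ = ∨-introʳ (any-mono xs P Q P⊆Q anyP′)

any-cong : ∀ xs (P Q : A → Bool) → (∀ x → P x ≡ Q x) → any P xs ≡ any Q xs
any-cong [] P Q P≡Q = refl
any-cong (y ∷ xs) P Q P≡Q = cong₂ _∨_ (P≡Q y) (any-cong xs P Q P≡Q)

∑-comm : ∀ (xs : List A) (ys : List B) (f : A → B → ℕ) → ∑ xs (λ x → ∑ ys (f x)) ≡ ∑ ys (λ y → ∑ xs (λ x → f x y))
∑-comm [] ys f = sym (∑-zero ys)
∑-comm (x ∷ xs) ys f = trans (cong (∑ ys (f x) +_) (∑-comm xs ys f)) (sym (∑-distrib-+ ys (f x) _))

∑-map : ∀ (xs : List A) (g : A → B) (f : B → ℕ) → ∑ (map g xs) f ≡ ∑ xs (f ∘ g)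
∑-map xs g f = cong sum (sym (map-∘ xs))

-- Hall's theorem

module Hall {A : Set} (elements : List A) (_==_ : A → A → Bool)
  (==-sound : ∀ x y → x == y ≡ true → x ≡ y) (==-refl : ∀ x → x == x ≡ true)
  (∈-elements : ∀ x → x ∈ˡ elements) (count-==-≤1 : ∀ y → count elements (_== y) ≤ 1)
  (adj : A → A → Bool) where

  Pred : Set
  Pred = A → Bool

  #_ : Pred → ℕ
  # P = count elements P

  neighbours : Pred → Pred → Pred
  neighbours R X b = R b ∧ any (λ a → X a ∧ adj a b) elements

  record Matching (L R : Pred) : Set where
    field
      partner : (a : A) → L a ≡ true → A
      partner-∈ : ∀ a La → R (partner a La) ≡ true
      partner-adj : ∀ a La → adj a (partner a La) ≡ true
      partner-injective : ∀ a La a′ La′ → partner a La ≡ partner a′ La′ → a ≡ a′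

  Deficient : Pred → Pred → Set
  Deficient L R = Σ Pred λ X → (∀ a → X a ≡ true → L a ≡ true) × # neighbours R X < # X

  -- Enumerating all predicates on the finite universe makes the existence of
  -- a tight set (see Step) decidable.
  update : Pred → A → Bool → Pred
  update S x b y = if y == x then b else S y

  extendAt : A → List Pred → List Pred
  extendAt x [] = []
  extendAt x (S ∷ Ss) = update S x true ∷ update S x false ∷ extendAt x Ss

  predicates : List A → List Pred
  predicates [] = (λ _ → false) ∷ []
  predicates (x ∷ xs) = extendAt x (predicates xs)

  update-∈-extendAt : ∀ x S Ss b → S ∈ˡ Ss → update S x b ∈ˡ extendAt x Ss
  update-∈-extendAt x S (S′ ∷ Ss) true (here refl) = here refl
  update-∈-extendAt x S (S′ ∷ Ss) false (here refl) = there (here refl)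
  update-∈-extendAt x S (S′ ∷ Ss) b (there S∈Ss) = there (there (update-∈-extendAt x S Ss b S∈Ss))

  predicates-complete : ∀ xs (X : Pred) → Σ Pred λ S → S ∈ˡ predicates xs × (∀ y → y ∈ˡ xs → S y ≡ X y)
  predicates-complete [] X = (λ _ → false) , here refl , λ y ()
  predicates-complete (x ∷ xs) X =
    let (S , S∈ , S≈X) = predicates-complete xs X in
    update S x (X x) , update-∈-extendAt x S (predicates xs) (X x) S∈ , agrees S S≈X
    where
    agrees : ∀ S → (∀ y → y ∈ˡ xs → S y ≡ X y) → ∀ y → y ∈ˡ (x ∷ xs) → update S x (X x) y ≡ X y
    agrees S S≈X y (here refl) rewrite ==-refl y = refl
    agrees S S≈X y (there y∈xs) with y == x in y==x
    ... | true rewrite ==-sound y x y==x = refl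
    ... | false = S≈X y y∈xs

  emptyMatching : ∀ L R → # L ≡ 0 → Matching L R
  emptyMatching L R #L≡0 = record
    { partner = λ a La → ⊥-elim (L-empty a La)
    ; partner-∈ = λ a La → ⊥-elim (L-empty a La)
    ; partner-adj = λ a La → ⊥-elim (L-empty a La)
    ; partner-injective = λ a La _ _ _ → ⊥-elim (L-empty a La)
    }
    where
    L-empty : ∀ a → L a ≡ true → ⊥
    L-empty a La = ≡true⇒≢false La (count≡0⇒false elements L #L≡0 a (∈-elements a))

  -- The usual induction for Hall's theorem: if some nonempty proper X ⊆ L
  -- has no surplus (|N(X)| ≤ |X|), split the problem along X and N(X);
  -- otherwise every such X has surplus, so an arbitrary edge can be kept.
  module Step (n : ℕ) (hall-n : ∀ L R → # L ≤ n → Matching L R ⊎ Deficient L R)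
              (L R : Pred) (#L≤1+n : # L ≤ suc n) where

    _∩L : Pred → Pred
    (X ∩L) a = X a ∧ L a

    Tight : Pred → Set
    Tight X = 1 ≤ # (X ∩L) × # (X ∩L) < # L × # neighbours R (X ∩L) ≤ # (X ∩L)

    tight? : ∀ X → Dec (Tight X)
    tight? X = (1 ≤? # (X ∩L)) ×-dec ((suc (# (X ∩L)) ≤? # L) ×-dec (# neighbours R (X ∩L) ≤? # (X ∩L)))

    tight-cong : ∀ X X′ → (∀ a → X a ≡ X′ a) → Tight X → Tight X′
    tight-cong X X′ X≈X′ (nonempty , proper , noSurplus) =
      subst (1 ≤_) #∩≡ nonempty , subst (_< # L) #∩≡ proper , subst₂ _≤_ #N≡ #∩≡ noSurplus
      where
      ∩≈ : ∀ a → (X ∩L) a ≡ (X′ ∩L) a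
      ∩≈ a = cong (_∧ L a) (X≈X′ a)
      #∩≡ : # (X ∩L) ≡ # (X′ ∩L)
      #∩≡ = count-cong elements _ _ ∩≈
      #N≡ : # neighbours R (X ∩L) ≡ # neighbours R (X′ ∩L)
      #N≡ = count-cong elements _ _ λ b → cong (R b ∧_) (any-cong elements _ _ λ a → cong (_∧ adj a b) (∩≈ a))

    module TightCase (X : Pred) (tight : Tight X) where

      Y : Pred
      Y = X ∩L

      Y-nonempty : 1 ≤ # Y
      Y-nonempty = proj₁ tight

      Y-proper : # Y < # L
      Y-proper = proj₁ (proj₂ tight)

      Y-no-surplus : # neighbours R Y ≤ # Y
      Y-no-surplus = proj₂ (proj₂ tight)

      L₂ : Pred
      L₂ a = L a ∧ not (Y a)

      R₂ : Pred
      R₂ b = R b ∧ not (neighbours R Y b)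

      Y⊆L : ∀ a → Y a ≡ true → L a ≡ true
      Y⊆L a Ya = ∧-elimʳ {X a} Ya

      #Y≤n : # Y ≤ n
      #Y≤n = ≤-pred (≤-trans Y-proper #L≤1+n)

      #L₂≤n : # L₂ ≤ n
      #L₂≤n = ≤-pred (≤-trans #L₂<#L #L≤1+n)
        where
        L∧Y≈Y : ∀ a → (L a ∧ Y a) ≡ Y a
        L∧Y≈Y a with X a | L a
        ... | true | true = refl
        ... | true | false = refl
        ... | false | true = refl
        ... | false | false = refl
        #L₂<#L : # L₂ < # L
        #L₂<#L = begin-strict
          # L₂                        <⟨ +-monoˡ-≤ (# L₂) Y-nonempty ⟩
          # Y + # L₂                  ≡⟨ cong (_+ # L₂) (count-cong elements _ _ L∧Y≈Y) ⟨
          # (λ a → L a ∧ Y a) + # L₂  ≡⟨ count-split elements L Y ⟨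
          # L                         ∎
          where open ≤-Reasoning

      deficient-Y : Deficient Y (neighbours R Y) → Deficient L R
      deficient-Y (Z , Z⊆Y , deficient) = Z , (λ a Za → Y⊆L a (Z⊆Y a Za)) , ≤-<-trans (count-mono elements _ _ N⊆N) deficient
        where
        N⊆N : ∀ b → neighbours R Z b ≡ true → neighbours (neighbours R Y) Z b ≡ true
        N⊆N b NZb = ∧-intro (∧-intro (∧-elimˡ NZb) (any-mono elements _ _ (λ a Za∧adj → ∧-intro (Z⊆Y a (∧-elimˡ Za∧adj)) (∧-elimʳ {Z a} Za∧adj)) anyZ)) anyZ
          where
          anyZ : any (λ a → Z a ∧ adj a b) elements ≡ true
          anyZ = ∧-elimʳ {R b} NZb

      deficient-L₂ : Deficient L₂ R₂ → Deficient L R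
      deficient-L₂ (Z , Z⊆L₂ , deficient) = W , W⊆L , #NW<#W
        where
        W : Pred
        W a = Y a ∨ Z a
        W⊆L : ∀ a → W a ≡ true → L a ≡ true
        W⊆L a Wa with ∨-elim {Y a} Wa
        ... | inj₁ Ya = Y⊆L a Ya
        ... | inj₂ Za = ∧-elimˡ (Z⊆L₂ a Za)
        Y∩Z≡∅ : ∀ a → Y a ≡ true → Z a ≡ false
        Y∩Z≡∅ a Ya with Z a in Za
        ... | false = refl
        ... | true = ⊥-elim (≡true⇒≢false Ya (not-elim (∧-elimʳ {L a} (Z⊆L₂ a Za))))
        NW⊆ : ∀ b → neighbours R W b ≡ true → (neighbours R Y b ∨ neighbours R₂ Z b) ≡ true
        NW⊆ b NWb with neighbours R Y b in NYb
        ... | true = refl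
        ... | false with any-witness elements _ (∧-elimʳ {R b} NWb)
        ... | a , Wa∧adj with ∨-elim {Y a} (∧-elimˡ Wa∧adj)
        ... | inj₁ Ya = ⊥-elim (≡true⇒≢false (∧-intro (∧-elimˡ NWb) (any-intro elements (λ a → Y a ∧ adj a b) a (∈-elements a) (∧-intro Ya (∧-elimʳ {W a} Wa∧adj)))) NYb)
        ... | inj₂ Za = ∧-intro (∧-intro (∧-elimˡ NWb) refl) (any-intro elements _ a (∈-elements a) (∧-intro Za (∧-elimʳ {W a} Wa∧adj)))
        #NW<#W : # neighbours R W < # W
        #NW<#W = begin-strict
          # neighbours R W                                ≤⟨ count-mono elements _ _ NW⊆ ⟩
          # (λ b → neighbours R Y b ∨ neighbours R₂ Z b)  ≤⟨ count-∨ elements _ _ ⟩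
          # neighbours R Y + # neighbours R₂ Z            <⟨ +-mono-≤-< Y-no-surplus deficient ⟩
          # Y + # Z                                       ≡⟨ count-∨-disjoint elements Y Z Y∩Z≡∅ ⟨
          # W                                             ∎
          where open ≤-Reasoning

      combine : Matching Y (neighbours R Y) → Matching L₂ R₂ → Matching L R
      combine M₁ M₂ = record
        { partner = λ a La → partner′ a La (Y a) refl
        ; partner-∈ = λ a La → partner-∈′ a La (Y a) refl
        ; partner-adj = λ a La → partner-adj′ a La (Y a) refl
        ; partner-injective = λ a La a′ La′ → partner-injective′ a La (Y a) refl a′ La′ (Y a′) refl
        }
        where
        module M₁ = Matching M₁
        module M₂ = Matching M₂
        L₂-intro : ∀ a → L a ≡ true → Y a ≡ false → L₂ a ≡ true
        L₂-intro a La Ya rewrite La | Ya = refl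
        partner′ : (a : A) → L a ≡ true → (y : Bool) → Y a ≡ y → A
        partner′ a La true Ya = M₁.partner a Ya
        partner′ a La false Ya = M₂.partner a (L₂-intro a La Ya)
        partner-∈′ : ∀ a La y Ya → R (partner′ a La y Ya) ≡ true
        partner-∈′ a La true Ya = ∧-elimˡ (M₁.partner-∈ a Ya)
        partner-∈′ a La false Ya = ∧-elimˡ (M₂.partner-∈ a (L₂-intro a La Ya))
        partner-adj′ : ∀ a La y Ya → adj a (partner′ a La y Ya) ≡ true
        partner-adj′ a La true Ya = M₁.partner-adj a Ya
        partner-adj′ a La false Ya = M₂.partner-adj a (L₂-intro a La Ya)
        M₂-outside-NY : ∀ a L₂a → neighbours R Y (M₂.partner a L₂a) ≡ false
        M₂-outside-NY a L₂a = not-elim (∧-elimʳ {R (M₂.partner a L₂a)} (M₂.partner-∈ a L₂a))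
        partner-injective′ : ∀ a La y Ya a′ La′ y′ Ya′ → partner′ a La y Ya ≡ partner′ a′ La′ y′ Ya′ → a ≡ a′
        partner-injective′ a La true Ya a′ La′ true Ya′ same = M₁.partner-injective a Ya a′ Ya′ same
        partner-injective′ a La false Ya a′ La′ false Ya′ same = M₂.partner-injective a _ a′ _ same
        partner-injective′ a La true Ya a′ La′ false Ya′ same =
          ⊥-elim (≡true⇒≢false (M₁.partner-∈ a Ya) (subst (λ b → neighbours R Y b ≡ false) (sym same) (M₂-outside-NY a′ _)))
        partner-injective′ a La false Ya a′ La′ true Ya′ same =
          ⊥-elim (≡true⇒≢false (M₁.partner-∈ a′ Ya′) (subst (λ b → neighbours R Y b ≡ false) same (M₂-outside-NY a _)))

      result : Matching L R ⊎ Deficient L R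
      result with hall-n Y (neighbours R Y) #Y≤n | hall-n L₂ R₂ #L₂≤n
      ... | inj₂ deficient | _ = inj₂ (deficient-Y deficient)
      ... | inj₁ _ | inj₂ deficient = inj₂ (deficient-L₂ deficient)
      ... | inj₁ M₁ | inj₁ M₂ = inj₁ (combine M₁ M₂)

    module LooseCase (noneTight : ∀ X → ¬ Tight X) (a : A) (La : L a ≡ true) where

      ⁅a⁆ : Pred
      ⁅a⁆ = _== a

      ⁅a⁆⊆L : ∀ x → ⁅a⁆ x ≡ true → L x ≡ true
      ⁅a⁆⊆L x x==a rewrite ==-sound x a x==a = La

      module WithEdge (b : A) (b∈N⁅a⁆ : neighbours R ⁅a⁆ b ≡ true) where

        adj-ab : adj a b ≡ true
        adj-ab = let (x , x==a∧adj) = any-witness elements _ (∧-elimʳ {R b} b∈N⁅a⁆) in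
          subst (λ z → adj z b ≡ true) (==-sound x a (∧-elimˡ x==a∧adj)) (∧-elimʳ {x == a} x==a∧adj)

        L′ : Pred
        L′ x = L x ∧ not (x == a)

        R′ : Pred
        R′ y = R y ∧ not (y == b)

        #L′<#L : # L′ < # L
        #L′<#L = begin-strict
          # L′                          <⟨ +-monoˡ-≤ (# L′) (count-pos elements _ a (∈-elements a) (∧-intro La (==-refl a))) ⟩
          # (λ x → L x ∧ ⁅a⁆ x) + # L′  ≡⟨ count-split elements L ⁅a⁆ ⟨
          # L                           ∎
          where open ≤-Reasoning

        extend : Matching L′ R′ → Matching L R
        extend M = record
          { partner = λ x Lx → partner′ x Lx (x == a) refl
          ; partner-∈ = λ x Lx → partner-∈′ x Lx (x == a) refl
          ; partner-adj = λ x Lx → partner-adj′ x Lx (x == a) refl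
          ; partner-injective = λ x Lx x′ Lx′ → partner-injective′ x Lx (x == a) refl x′ Lx′ (x′ == a) refl
          }
          where
          module M = Matching M
          L′-intro : ∀ x → L x ≡ true → x == a ≡ false → L′ x ≡ true
          L′-intro x Lx x≠a rewrite Lx | x≠a = refl
          partner′ : (x : A) → L x ≡ true → (e : Bool) → x == a ≡ e → A
          partner′ x Lx true x==a = b
          partner′ x Lx false x≠a = M.partner x (L′-intro x Lx x≠a)
          partner-∈′ : ∀ x Lx e x==a → R (partner′ x Lx e x==a) ≡ true
          partner-∈′ x Lx true x==a = ∧-elimˡ b∈N⁅a⁆
          partner-∈′ x Lx false x≠a = ∧-elimˡ (M.partner-∈ x _)
          partner-adj′ : ∀ x Lx e x==a → adj x (partner′ x Lx e x==a) ≡ true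
          partner-adj′ x Lx true x==a = subst (λ z → adj z b ≡ true) (sym (==-sound x a x==a)) adj-ab
          partner-adj′ x Lx false x≠a = M.partner-adj x _
          M-avoids-b : ∀ x L′x → M.partner x L′x == b ≡ false
          M-avoids-b x L′x = not-elim (∧-elimʳ {R (M.partner x L′x)} (M.partner-∈ x L′x))
          partner-injective′ : ∀ x Lx e x==a x′ Lx′ e′ x′==a → partner′ x Lx e x==a ≡ partner′ x′ Lx′ e′ x′==a → x ≡ x′
          partner-injective′ x Lx true x==a x′ Lx′ true x′==a _ = trans (==-sound x a x==a) (sym (==-sound x′ a x′==a))
          partner-injective′ x Lx false x≠a x′ Lx′ false x′≠a same = M.partner-injective x _ x′ _ same
          partner-injective′ x Lx true x==a x′ Lx′ false x′≠a same =
            ⊥-elim (≡true⇒≢false (==-refl b) (subst (λ z → z == b ≡ false) (sym same) (M-avoids-b x′ _)))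
          partner-injective′ x Lx false x≠a x′ Lx′ true x′==a same =
            ⊥-elim (≡true⇒≢false (==-refl b) (subst (λ z → z == b ≡ false) same (M-avoids-b x _)))

        -- Removing the single vertex b from R costs each X ⊆ L′ at most one
        -- neighbour, so a deficient X would be tight for L and R.
        not-deficient : ¬ Deficient L′ R′
        not-deficient (X , X⊆L′ , deficient) = noneTight X (nonempty , proper , noSurplus)
          where
          X∩L≈X : ∀ x → (X ∩L) x ≡ X x
          X∩L≈X x with X x in Xx
          ... | true = ∧-elimˡ (X⊆L′ x Xx)
          ... | false = refl
          #X∩L≡#X : # (X ∩L) ≡ # X
          #X∩L≡#X = count-cong elements _ _ X∩L≈X
          #N≡ : # neighbours R (X ∩L) ≡ # neighbours R X
          #N≡ = count-cong elements _ _ λ y → cong (R y ∧_) (any-cong elements _ _ λ x → cong (_∧ adj x y) (X∩L≈X x))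
          nonempty : 1 ≤ # (X ∩L)
          nonempty = subst (1 ≤_) (sym #X∩L≡#X) (≤-<-trans z≤n deficient)
          proper : # (X ∩L) < # L
          proper = subst (_< # L) (sym #X∩L≡#X) (≤-<-trans (count-mono elements _ _ X⊆L′) #L′<#L)
          NX⊆ : ∀ y → neighbours R X y ≡ true → (neighbours R′ X y ∨ y == b) ≡ true
          NX⊆ y NXy with y == b
          ... | true = ∨-introʳ refl
          ... | false = ∨-introˡ (∧-intro (∧-intro (∧-elimˡ {R y} NXy) refl) (∧-elimʳ {R y} NXy))
          noSurplus : # neighbours R (X ∩L) ≤ # (X ∩L)
          noSurplus = subst₂ _≤_ (sym #N≡) (sym #X∩L≡#X) (begin
            # neighbours R X                      ≤⟨ count-mono elements _ _ NX⊆ ⟩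
            # (λ y → neighbours R′ X y ∨ y == b)  ≤⟨ count-∨ elements _ _ ⟩
            # neighbours R′ X + # (_== b)         ≤⟨ +-monoʳ-≤ (# neighbours R′ X) (count-==-≤1 b) ⟩
            # neighbours R′ X + 1                 ≡⟨ +-comm (# neighbours R′ X) 1 ⟩
            suc (# neighbours R′ X)               ≤⟨ deficient ⟩
            # X                                   ∎)
            where open ≤-Reasoning

        result : Matching L R ⊎ Deficient L R
        result with hall-n L′ R′ (≤-pred (≤-trans #L′<#L #L≤1+n))
        ... | inj₁ M = inj₁ (extend M)
        ... | inj₂ deficient = ⊥-elim (not-deficient deficient)

      result : Matching L R ⊎ Deficient L R
      result with # neighbours R ⁅a⁆ ≟ 0
      ... | yes #N≡0 = inj₂ (⁅a⁆ , ⁅a⁆⊆L , subst (_< # ⁅a⁆) (sym #N≡0) (count-pos elements ⁅a⁆ a (∈-elements a) (==-refl a)))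
      ... | no #N≢0 = let (b , _ , b∈N) = count-witness elements (neighbours R ⁅a⁆) (n≢0⇒n>0 #N≢0) in WithEdge.result b b∈N

    noneTight-or-witness : (∀ X → ¬ Tight X) ⊎ Σ Pred Tight
    noneTight-or-witness with any? tight? (predicates elements)
    ... | yes someTight = inj₂ (satisfied someTight)
    ... | no noneTight = inj₁ λ X tight →
      let (S , S∈ , S≈X) = predicates-complete elements X in
      noneTight (lose S∈ (tight-cong X S (λ y → sym (S≈X y (∈-elements y))) tight))

    result : Matching L R ⊎ Deficient L R
    result with # L ≟ 0 | noneTight-or-witness
    ... | yes #L≡0 | _ = inj₁ (emptyMatching L R #L≡0)
    ... | no _ | inj₂ (X , tight) = TightCase.result X tight
    ... | no #L≢0 | inj₁ noneTight =
      let (a , _ , La) = count-witness elements L (n≢0⇒n>0 #L≢0) in LooseCase.result noneTight a La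

  matching-or-deficient : ∀ L R → Matching L R ⊎ Deficient L R
  matching-or-deficient L R = go (# L) L R ≤-refl
    where
    go : ∀ n L R → # L ≤ n → Matching L R ⊎ Deficient L R
    go zero L R #L≤0 = inj₁ (emptyMatching L R (n≤0⇒n≡0 #L≤0))
    go (suc n) L R #L≤1+n = Step.result n (go n) L R #L≤1+n

-- Arithmetic of binomial coefficients

≤-by-increments : ∀ (f g Δf Δg : ℕ → ℕ) → f 0 ≤ g 0 →
  (∀ d → f (suc d) ≡ Δf d + f d) → (∀ d → g (suc d) ≡ Δg d + g d) → (∀ d → Δf d ≤ Δg d) → ∀ d → f d ≤ g d
≤-by-increments f g Δf Δg base f-step g-step Δf≤Δg zero = base
≤-by-increments f g Δf Δg base f-step g-step Δf≤Δg (suc d) = begin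
  f (suc d)   ≡⟨ f-step d ⟩
  Δf d + f d  ≤⟨ +-mono-≤ (Δf≤Δg d) (≤-by-increments f g Δf Δg base f-step g-step Δf≤Δg d) ⟩
  Δg d + g d  ≡⟨ g-step d ⟨
  g (suc d)   ∎
  where open ≤-Reasoning

m+n≡o⇒n≤o∸1 : ∀ {m n o} → m + n ≡ o → 1 ≤ m → n ≤ o ∸ 1
m+n≡o⇒n≤o∸1 {suc m} {n} m+n≡o _ = subst (λ o → n ≤ o ∸ 1) m+n≡o (m≤n+m n m)

C-pascal : ∀ n r → suc n C suc r ≡ n C r + n C suc r
C-pascal n r = sym (nCk+nC[k+1]≡[n+1]C[k+1] n r)

C-≤-suc : ∀ n r → n C r ≤ suc n C r
C-≤-suc n zero = ≤-refl
C-≤-suc n (suc r) = ≤-trans (m≤n+m (n C suc r) (n C r)) (≤-reflexive (sym (C-pascal n r)))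

C-monoˡ-≤ : ∀ r {m n} → m ≤ n → m C r ≤ n C r
C-monoˡ-≤ r m≤n = go (≤⇒≤′ m≤n)
  where
  go : ∀ {m n} → m ≤′ n → m C r ≤ n C r
  go ≤′-refl = ≤-refl
  go (≤′-step m≤′n) = ≤-trans (go m≤′n) (C-≤-suc _ r)

C-shift : ∀ j n r → n C r ≤ (j + n) C (j + r)
C-shift zero n r = ≤-refl
C-shift (suc j) n r = ≤-trans (C-shift j n r) (≤-trans (m≤m+n _ _) (≤-reflexive (sym (C-pascal (j + n) (j + r)))))

C2-suc : ∀ n → suc n C 2 ≡ n + n C 2
C2-suc n = trans (C-pascal n 1) (cong (_+ n C 2) (nC1≡n n))

2*C2-suc : ∀ n → 2 * (suc n C 2) ≡ 2 * n + 2 * (n C 2)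
2*C2-suc n = trans (cong (2 *_) (C2-suc n)) (*-distribˡ-+ 2 n (n C 2))

2*nC2≤n*n : ∀ n → 2 * (n C 2) ≤ n * n
2*nC2≤n*n = ≤-by-increments (λ n → 2 * (n C 2)) (λ n → n * n) (2 *_) (λ n → 1 + 2 * n) z≤n 2*C2-suc square-suc (λ n → n≤1+n (2 * n))
  where
  square-suc : ∀ n → suc n * suc n ≡ 1 + 2 * n + n * n
  square-suc = solve-∀

-- Subsets of Fin n

subsets : (n : ℕ) → List (Subset n)
subsets zero = [] ∷ []
subsets (suc n) = map (true ∷_) (subsets n) ++ map (false ∷_) (subsets n)

∈-subsets : ∀ n (K : Subset n) → K ∈ˡ subsets n
∈-subsets zero [] = here refl
∈-subsets (suc n) (true ∷ K) = ∈-++⁺ˡ (∈-map⁺ (true ∷_) (∈-subsets n K))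
∈-subsets (suc n) (false ∷ K) = ∈-++⁺ʳ (map (true ∷_) (subsets n)) (∈-map⁺ (false ∷_) (∈-subsets n K))

count-subsets-suc : ∀ n (P : Subset (suc n) → Bool) →
  count (subsets (suc n)) P ≡ count (subsets n) (P ∘ (true ∷_)) + count (subsets n) (P ∘ (false ∷_))
count-subsets-suc n P = trans (∑-++ (map (true ∷_) (subsets n)) _ _) (cong₂ _+_ (∑-map (subsets n) _ _) (∑-map (subsets n) _ _))

_==ˢ_ : ∀ {n} → Subset n → Subset n → Bool
[] ==ˢ [] = true
(true ∷ p) ==ˢ (true ∷ q) = p ==ˢ q
(false ∷ p) ==ˢ (false ∷ q) = p ==ˢ q
(true ∷ p) ==ˢ (false ∷ q) = false
(false ∷ p) ==ˢ (true ∷ q) = false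

==ˢ-sound : ∀ {n} (p q : Subset n) → p ==ˢ q ≡ true → p ≡ q
==ˢ-sound [] [] _ = refl
==ˢ-sound (true ∷ p) (true ∷ q) p==q = cong (true ∷_) (==ˢ-sound p q p==q)
==ˢ-sound (false ∷ p) (false ∷ q) p==q = cong (false ∷_) (==ˢ-sound p q p==q)

==ˢ-refl : ∀ {n} (p : Subset n) → p ==ˢ p ≡ true
==ˢ-refl [] = refl
==ˢ-refl (true ∷ p) = ==ˢ-refl p
==ˢ-refl (false ∷ p) = ==ˢ-refl p

count-==ˢ-≤1 : ∀ n (q : Subset n) → count (subsets n) (_==ˢ q) ≤ 1
count-==ˢ-≤1 zero [] = ≤-refl
count-==ˢ-≤1 (suc n) (true ∷ q) = begin
  count (subsets (suc n)) (_==ˢ (true ∷ q))                     ≡⟨ count-subsets-suc n (_==ˢ (true ∷ q)) ⟩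
  count (subsets n) (_==ˢ q) + count (subsets n) (λ _ → false)  ≡⟨ cong (count (subsets n) (_==ˢ q) +_) (count-false (subsets n) _ (λ _ → refl)) ⟩
  count (subsets n) (_==ˢ q) + 0                                ≤⟨ +-monoˡ-≤ 0 (count-==ˢ-≤1 n q) ⟩
  1                                                             ∎
  where open ≤-Reasoning
count-==ˢ-≤1 (suc n) (false ∷ q) = begin
  count (subsets (suc n)) (_==ˢ (false ∷ q))                    ≡⟨ count-subsets-suc n (_==ˢ (false ∷ q)) ⟩
  count (subsets n) (λ _ → false) + count (subsets n) (_==ˢ q)  ≡⟨ cong (_+ count (subsets n) (_==ˢ q)) (count-false (subsets n) _ (λ _ → refl)) ⟩
  count (subsets n) (_==ˢ q)                                    ≤⟨ count-==ˢ-≤1 n q ⟩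
  1                                                             ∎
  where open ≤-Reasoning

_⊆ᵇ_ : ∀ {n} → Subset n → Subset n → Bool
[] ⊆ᵇ [] = true
(false ∷ p) ⊆ᵇ (b ∷ q) = p ⊆ᵇ q
(true ∷ p) ⊆ᵇ (b ∷ q) = b ∧ (p ⊆ᵇ q)

⊆ᵇ⇒⊆ : ∀ {n} (p q : Subset n) → p ⊆ᵇ q ≡ true → p ⊆ q
⊆ᵇ⇒⊆ (true ∷ p) (true ∷ q) p⊆q here = here
⊆ᵇ⇒⊆ (true ∷ p) (true ∷ q) p⊆q (there x∈p) = there (⊆ᵇ⇒⊆ p q p⊆q x∈p)
⊆ᵇ⇒⊆ (false ∷ p) (b ∷ q) p⊆q (there x∈p) = there (⊆ᵇ⇒⊆ p q p⊆q x∈p)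

∅⊆ᵇ : ∀ {n} (q : Subset n) → ∅ ⊆ᵇ q ≡ true
∅⊆ᵇ [] = refl
∅⊆ᵇ (b ∷ q) = ∅⊆ᵇ q

∪-⊆ᵇ : ∀ {n} (p q r : Subset n) → (p ∪ q) ⊆ᵇ r ≡ (p ⊆ᵇ r) ∧ (q ⊆ᵇ r)
∪-⊆ᵇ [] [] [] = refl
∪-⊆ᵇ (true ∷ p) (true ∷ q) (true ∷ r) = ∪-⊆ᵇ p q r
∪-⊆ᵇ (true ∷ p) (true ∷ q) (false ∷ r) = refl
∪-⊆ᵇ (true ∷ p) (false ∷ q) (true ∷ r) = ∪-⊆ᵇ p q r
∪-⊆ᵇ (true ∷ p) (false ∷ q) (false ∷ r) = refl
∪-⊆ᵇ (false ∷ p) (true ∷ q) (true ∷ r) = ∪-⊆ᵇ p q r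
∪-⊆ᵇ (false ∷ p) (true ∷ q) (false ∷ r) = sym (∧-zeroʳ (p ⊆ᵇ r))
∪-⊆ᵇ (false ∷ p) (false ∷ q) (b ∷ r) = ∪-⊆ᵇ p q r

∣p∪q∣≤∣p∣+∣q∣ : ∀ {n} (p q : Subset n) → ∣ p ∪ q ∣ ≤ ∣ p ∣ + ∣ q ∣
∣p∪q∣≤∣p∣+∣q∣ [] [] = z≤n
∣p∪q∣≤∣p∣+∣q∣ (true ∷ p) (true ∷ q) = s≤s (≤-trans (∣p∪q∣≤∣p∣+∣q∣ p q) (+-monoʳ-≤ ∣ p ∣ (n≤1+n _)))
∣p∪q∣≤∣p∣+∣q∣ (true ∷ p) (false ∷ q) = s≤s (∣p∪q∣≤∣p∣+∣q∣ p q)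
∣p∪q∣≤∣p∣+∣q∣ (false ∷ p) (true ∷ q) = ≤-trans (s≤s (∣p∪q∣≤∣p∣+∣q∣ p q)) (≤-reflexive (sym (+-suc ∣ p ∣ ∣ q ∣)))
∣p∪q∣≤∣p∣+∣q∣ (false ∷ p) (false ∷ q) = ∣p∪q∣≤∣p∣+∣q∣ p q

≡ᵇ⇒≡-true : ∀ m n → (m ≡ᵇ n) ≡ true → m ≡ n
≡ᵇ⇒≡-true m n m≡ᵇn = ≡ᵇ⇒≡ m n (subst T (sym m≡ᵇn) tt)

≡⇒≡ᵇ-true : ∀ m n → m ≡ n → (m ≡ᵇ n) ≡ true
≡⇒≡ᵇ-true m n m≡n = Equivalence.to T-≡ (≡⇒≡ᵇ m n m≡n)

>⇒≡ᵇ-false : ∀ m n → m < n → (n ≡ᵇ m) ≡ false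
>⇒≡ᵇ-false zero (suc n) _ = refl
>⇒≡ᵇ-false (suc m) (suc n) (s≤s m<n) = >⇒≡ᵇ-false m n m<n

HasSize : ∀ {n} → ℕ → Subset n → Bool
HasSize r K = ∣ K ∣ ≡ᵇ r

count-supersets : ∀ n (U : Subset n) f r → ∣ U ∣ + f ≡ n →
                  count (subsets n) (λ K → (U ⊆ᵇ K) ∧ HasSize (∣ U ∣ + r) K) ≡ f C r
count-supersets zero [] zero zero _ = refl
count-supersets zero [] zero (suc r) _ = refl
count-supersets (suc n) (true ∷ U) f r ∣U∣+f≡n = begin
  count (subsets (suc n)) (λ K → ((true ∷ U) ⊆ᵇ K) ∧ HasSize (suc ∣ U ∣ + r) K)
          ≡⟨ count-subsets-suc n _ ⟩
  count (subsets n) (λ K → (U ⊆ᵇ K) ∧ HasSize (∣ U ∣ + r) K) + count (subsets n) (λ _ → false)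
          ≡⟨ cong₂ _+_ (count-supersets n U f r (suc-injective ∣U∣+f≡n)) (count-false (subsets n) _ (λ _ → refl)) ⟩
  f C r + 0
          ≡⟨ +-identityʳ (f C r) ⟩
  f C r  ∎
  where open ≡-Reasoning
count-supersets (suc n) (false ∷ U) zero r ∣U∣≡1+n =
  ⊥-elim (<-irrefl refl (≤-trans (≤-reflexive (trans (sym ∣U∣≡1+n) (+-identityʳ _))) (∣p∣≤n U)))
count-supersets (suc n) (false ∷ U) (suc f) zero ∣U∣+1+f≡1+n = begin
  count (subsets (suc n)) (λ K → ((false ∷ U) ⊆ᵇ K) ∧ HasSize (∣ U ∣ + 0) K)
              ≡⟨ count-subsets-suc n _ ⟩
  count (subsets n) (λ K → (U ⊆ᵇ K) ∧ HasSize (∣ U ∣ + 0) (true ∷ K)) + count (subsets n) (λ K → (U ⊆ᵇ K) ∧ HasSize (∣ U ∣ + 0) K)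
              ≡⟨ cong₂ _+_ (count-false (subsets n) _ too-big) (count-supersets n U f zero (suc-injective (trans (sym (+-suc ∣ U ∣ f)) ∣U∣+1+f≡1+n))) ⟩
  0 + f C 0
              ≡⟨⟩
  suc f C 0  ∎
  where
  open ≡-Reasoning
  too-big : ∀ K → (U ⊆ᵇ K) ∧ HasSize (∣ U ∣ + 0) (true ∷ K) ≡ false
  too-big K with U ⊆ᵇ K in U⊆K
  ... | false = refl
  ... | true rewrite +-identityʳ ∣ U ∣ = >⇒≡ᵇ-false ∣ U ∣ (suc ∣ K ∣) (s≤s (p⊆q⇒∣p∣≤∣q∣ (⊆ᵇ⇒⊆ U K U⊆K)))
count-supersets (suc n) (false ∷ U) (suc f) (suc r) ∣U∣+1+f≡1+n = begin
  count (subsets (suc n)) (λ K → ((false ∷ U) ⊆ᵇ K) ∧ HasSize (∣ U ∣ + suc r) K)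
                  ≡⟨ count-subsets-suc n _ ⟩
  count (subsets n) (λ K → (U ⊆ᵇ K) ∧ HasSize (∣ U ∣ + suc r) (true ∷ K)) + count (subsets n) (λ K → (U ⊆ᵇ K) ∧ HasSize (∣ U ∣ + suc r) K)
                  ≡⟨ cong₂ _+_ (count-cong (subsets n) _ _ λ K → cong (λ s → (U ⊆ᵇ K) ∧ (suc ∣ K ∣ ≡ᵇ s)) (+-suc ∣ U ∣ r)) refl ⟩
  count (subsets n) (λ K → (U ⊆ᵇ K) ∧ HasSize (∣ U ∣ + r) K) + count (subsets n) (λ K → (U ⊆ᵇ K) ∧ HasSize (∣ U ∣ + suc r) K)
                  ≡⟨ cong₂ _+_ (count-supersets n U f r ∣U∣+f≡n) (count-supersets n U f (suc r) ∣U∣+f≡n) ⟩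
  f C r + f C suc r
                  ≡⟨ C-pascal f r ⟨
  suc f C suc r  ∎
  where
  open ≡-Reasoning
  ∣U∣+f≡n : ∣ U ∣ + f ≡ n
  ∣U∣+f≡n = suc-injective (trans (sym (+-suc ∣ U ∣ f)) ∣U∣+1+f≡1+n)

count-subsets : ∀ n (K : Subset n) r → count (subsets n) (λ P → (P ⊆ᵇ K) ∧ HasSize r P) ≡ ∣ K ∣ C r
count-subsets zero [] zero = refl
count-subsets zero [] (suc r) = refl
count-subsets (suc n) (true ∷ K) zero = begin
  count (subsets (suc n)) (λ P → (P ⊆ᵇ (true ∷ K)) ∧ HasSize 0 P)
                  ≡⟨ count-subsets-suc n _ ⟩
  count (subsets n) (λ P → (P ⊆ᵇ K) ∧ false) + count (subsets n) (λ P → (P ⊆ᵇ K) ∧ HasSize 0 P)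
                  ≡⟨ cong₂ _+_ (count-false (subsets n) _ (λ P → ∧-zeroʳ (P ⊆ᵇ K))) (count-subsets n K zero) ⟩
  0 + ∣ K ∣ C 0
                  ≡⟨⟩
  suc ∣ K ∣ C 0  ∎
  where open ≡-Reasoning
count-subsets (suc n) (true ∷ K) (suc r) = begin
  count (subsets (suc n)) (λ P → (P ⊆ᵇ (true ∷ K)) ∧ HasSize (suc r) P)
                      ≡⟨ count-subsets-suc n _ ⟩
  count (subsets n) (λ P → (P ⊆ᵇ K) ∧ HasSize r P) + count (subsets n) (λ P → (P ⊆ᵇ K) ∧ HasSize (suc r) P)
                      ≡⟨ cong₂ _+_ (count-subsets n K r) (count-subsets n K (suc r)) ⟩
  ∣ K ∣ C r + ∣ K ∣ C suc r
                      ≡⟨ C-pascal ∣ K ∣ r ⟨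
  suc ∣ K ∣ C suc r  ∎
  where open ≡-Reasoning
count-subsets (suc n) (false ∷ K) r = begin
  count (subsets (suc n)) (λ P → (P ⊆ᵇ (false ∷ K)) ∧ HasSize r P)
              ≡⟨ count-subsets-suc n _ ⟩
  count (subsets n) (λ _ → false) + count (subsets n) (λ P → (P ⊆ᵇ K) ∧ HasSize r P)
              ≡⟨ cong₂ _+_ (count-false (subsets n) _ (λ _ → refl)) (count-subsets n K r) ⟩
  ∣ K ∣ C r  ∎
  where open ≡-Reasoning

pair : ∀ {n} → Fin n → Fin n → Subset n
pair u v = ⁅ u ⁆ ∪ ⁅ v ⁆

∣pair∣≡2 : ∀ {n} (u v : Fin n) → u ≢ v → ∣ pair u v ∣ ≡ 2
∣pair∣≡2 zero zero u≢v = ⊥-elim (u≢v refl)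
∣pair∣≡2 {suc n} zero (suc v) _ = cong suc (trans (cong ∣_∣ (∪-identityˡ ⁅ v ⁆)) (∣⁅x⁆∣≡1 v))
∣pair∣≡2 {suc n} (suc u) zero _ = cong suc (trans (cong ∣_∣ (∪-identityʳ ⁅ u ⁆)) (∣⁅x⁆∣≡1 u))
∣pair∣≡2 (suc u) (suc v) u≢v = ∣pair∣≡2 u v (u≢v ∘ cong suc)

u∈pair : ∀ {n} (u v : Fin n) → u ∈ pair u v
u∈pair u v = x∈p∪q⁺ (inj₁ (x∈⁅x⁆ u))

v∈pair : ∀ {n} (u v : Fin n) → v ∈ pair u v
v∈pair u v = x∈p∪q⁺ (inj₂ (x∈⁅x⁆ v))

∈pair⁻ : ∀ {n} {x : Fin n} u v → x ∈ pair u v → x ≡ u ⊎ x ≡ v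
∈pair⁻ u v x∈pair with x∈p∪q⁻ ⁅ u ⁆ ⁅ v ⁆ x∈pair
... | inj₁ x∈⁅u⁆ = inj₁ (x∈⁅y⁆⇒x≡y u x∈⁅u⁆)
... | inj₂ x∈⁅v⁆ = inj₂ (x∈⁅y⁆⇒x≡y v x∈⁅v⁆)

pair-injective : ∀ {n} {u v u′ v′ : Fin n} → u <ᶠ v → u′ <ᶠ v′ → pair u v ≡ pair u′ v′ → u ≡ u′ × v ≡ v′
pair-injective {u = u} {v} {u′} {v′} u<v u′<v′ same with ∈pair⁻ u′ v′ (subst (u ∈_) same (u∈pair u v))
... | inj₁ u≡u′ with ∈pair⁻ u′ v′ (subst (v ∈_) same (v∈pair u v))
...   | inj₁ v≡u′ = ⊥-elim (<ᶠ-irrefl (trans u≡u′ (sym v≡u′)) u<v)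
...   | inj₂ v≡v′ = u≡u′ , v≡v′
pair-injective {u = u} {v} {u′} {v′} u<v u′<v′ same | inj₂ u≡v′ with ∈pair⁻ u v (subst (u′ ∈_) (sym same) (u∈pair u′ v′))
...   | inj₁ u′≡u = ⊥-elim (<ᶠ-irrefl (trans u′≡u u≡v′) u′<v′)
...   | inj₂ u′≡v = ⊥-elim (<ᶠ-irrefl refl (<ᶠ-trans u<v (subst₂ _<ᶠ_ u′≡v (sym u≡v′) u′<v′)))

-- Berge copies of K_t in a 2-coloured complete hypergraph

not-arrows-below : ∀ k t M → M < t → ¬ RamseyArrows k t M
not-arrows-below k t M M<t arrows with arrows (λ _ → true)
... | inj₁ (_ , φ-injective , _) = <⇒notInjective M<t φ-injective
... | inj₂ (_ , φ-injective , _) = <⇒notInjective M<t φ-injective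

-- The conditions C(t−4, k−4) ≥ 2(C(k,2) − 1) and C(t−2, k−2) ≥ 2 C(t,2) of the
-- paper, for t = 4 + t′ and k = 4 + k′.
BergeRamseyCondition : ℕ → ℕ → Set
BergeRamseyCondition t′ k′ = 2 * ((4 + k′) C 2 ∸ 1) ≤ t′ C k′ × 2 * ((4 + t′) C 2) ≤ (2 + t′) C (2 + k′)

module CompleteHypergraph (t′ k′ : ℕ) where

  t k : ℕ
  t = 4 + t′
  k = 4 + k′

  #_ : (Subset t → Bool) → ℕ
  # P = count (subsets t) P

  IsPair : Subset t → Bool
  IsPair = HasSize 2

  EdgeThrough : Subset t → Subset t → Bool
  EdgeThrough U K = (U ⊆ᵇ K) ∧ HasSize k K

  JoinEdge : Subset t → (Subset t → Bool) → Subset t → Bool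
  JoinEdge e₀ S K = EdgeThrough e₀ K ∧ any (λ s → S s ∧ (s ⊆ᵇ K)) (subsets t)

  count-pairs : # IsPair ≡ t C 2
  count-pairs = trans (count-cong (subsets t) _ _ ∅-superset) (count-supersets t ∅ t 2 (cong (_+ t) (∣⊥∣≡0 t)))
    where
    ∅-superset : ∀ K → IsPair K ≡ (∅ ⊆ᵇ K) ∧ HasSize (∣ ∅ {t} ∣ + 2) K
    ∅-superset K rewrite ∅⊆ᵇ K | ∣⊥∣≡0 t = refl

  count-edgesThrough : ∀ U j → ∣ U ∣ + j ≡ 4 → # (EdgeThrough U) ≡ (j + t′) C (j + k′)
  count-edgesThrough U j ∣U∣+j≡4 = begin
    # (EdgeThrough U)                                  ≡⟨ count-cong (subsets t) _ _ size-k ⟩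
    # (λ K → (U ⊆ᵇ K) ∧ HasSize (∣ U ∣ + (j + k′)) K)  ≡⟨ count-supersets t U (j + t′) (j + k′) (shift t′) ⟩
    (j + t′) C (j + k′)                                ∎
    where
    open ≡-Reasoning
    shift : ∀ x → ∣ U ∣ + (j + x) ≡ 4 + x
    shift x = trans (sym (+-assoc ∣ U ∣ j x)) (cong (_+ x) ∣U∣+j≡4)
    size-k : ∀ K → EdgeThrough U K ≡ (U ⊆ᵇ K) ∧ HasSize (∣ U ∣ + (j + k′)) K
    size-k K rewrite shift k′ = refl

  module JoinEdgeBound (e₀ : Subset t) (e₀-pair : ∣ e₀ ∣ ≡ 2)
                       (S : Subset t → Bool) (S-pairs : ∀ s → S s ≡ true → ∣ s ∣ ≡ 2) where

    count-S≤ : # S ≤ t C 2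
    count-S≤ = subst (# S ≤_) count-pairs
      (count-mono (subsets t) S IsPair λ s Ss → ≡⇒≡ᵇ-true ∣ s ∣ 2 (S-pairs s Ss))

    when-e₀∈S : 2 * (t C 2) ≤ (2 + t′) C (2 + k′) → S e₀ ≡ true → 2 * # S ≤ # (JoinEdge e₀ S)
    when-e₀∈S room Se₀ = begin
      2 * # S              ≤⟨ *-monoʳ-≤ 2 count-S≤ ⟩
      2 * (t C 2)          ≤⟨ room ⟩
      (2 + t′) C (2 + k′)  ≡⟨ count-edgesThrough e₀ 2 (cong (_+ 2) e₀-pair) ⟨
      # (EdgeThrough e₀)   ≤⟨ count-mono (subsets t) _ _ joins ⟩
      # (JoinEdge e₀ S)    ∎
      where
      open ≤-Reasoning
      joins : ∀ K → EdgeThrough e₀ K ≡ true → JoinEdge e₀ S K ≡ true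
      joins K e₀⊆K = ∧-intro e₀⊆K (any-intro (subsets t) _ e₀ (∈-subsets t e₀) (∧-intro Se₀ (∧-elimˡ e₀⊆K)))

    module WhenE₀∉S (Se₀ : S e₀ ≡ false) where

      Incident : Subset t → Subset t → Bool
      Incident K s = S s ∧ EdgeThrough (s ∪ e₀) K

      incidences : ℕ
      incidences = ∑ (subsets t) (λ s → # (λ K → Incident K s))

      edges-per-pair : ∀ s → S s ≡ true → t′ C k′ ≤ # (λ K → Incident K s)
      edges-per-pair s Ss = begin
        t′ C k′                   ≤⟨ C-shift j t′ k′ ⟩
        (j + t′) C (j + k′)       ≡⟨ count-edgesThrough (s ∪ e₀) j (m+[n∸m]≡n ∣s∪e₀∣≤4) ⟨
        # (EdgeThrough (s ∪ e₀))  ≡⟨ count-cong (subsets t) _ _ (λ K → cong (_∧ EdgeThrough (s ∪ e₀) K) Ss) ⟨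
        # (λ K → Incident K s)    ∎
        where
        open ≤-Reasoning
        ∣s∪e₀∣≤4 : ∣ s ∪ e₀ ∣ ≤ 4
        ∣s∪e₀∣≤4 = ≤-trans (∣p∪q∣≤∣p∣+∣q∣ s e₀) (≤-reflexive (cong₂ _+_ (S-pairs s Ss) e₀-pair))
        j : ℕ
        j = 4 ∸ ∣ s ∪ e₀ ∣

      incidence-joinEdge : ∀ K s → Incident K s ≡ true → JoinEdge e₀ S K ≡ true
      incidence-joinEdge K s incident = ∧-intro (∧-intro (∧-elimʳ {s ⊆ᵇ K} s,e₀⊆K) (∧-elimʳ {(s ∪ e₀) ⊆ᵇ K} s∪e₀-edge))
        (any-intro (subsets t) _ s (∈-subsets t s) (∧-intro (∧-elimˡ {S s} incident) (∧-elimˡ {s ⊆ᵇ K} s,e₀⊆K)))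
        where
        s∪e₀-edge : EdgeThrough (s ∪ e₀) K ≡ true
        s∪e₀-edge = ∧-elimʳ {S s} incident
        s,e₀⊆K : ((s ⊆ᵇ K) ∧ (e₀ ⊆ᵇ K)) ≡ true
        s,e₀⊆K = trans (sym (∪-⊆ᵇ s e₀ K)) (∧-elimˡ s∪e₀-edge)

      -- The pairs incident to K are pairs of K other than e₀, itself a pair of K.
      pairs-per-edge : ∀ K → # (Incident K) ≤ boolToℕ (JoinEdge e₀ S K) * (k C 2 ∸ 1)
      pairs-per-edge K with JoinEdge e₀ S K in joinEdge
      ... | false = ≤-reflexive (count-false (subsets t) _ λ s → not-incident s (Incident K s) refl)
        where
        not-incident : ∀ s b → Incident K s ≡ b → b ≡ false
        not-incident s false _ = refl
        not-incident s true incident = ⊥-elim (≡true⇒≢false (incidence-joinEdge K s incident) joinEdge)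
      ... | true = begin
        # (Incident K)                        ≤⟨ count-mono (subsets t) _ _ other-pair ⟩
        # (λ s → PairOfK s ∧ not (s ==ˢ e₀))  ≤⟨ m+n≡o⇒n≤o∸1 (trans (sym (count-split (subsets t) PairOfK (_==ˢ e₀))) #PairOfK) e₀-counted ⟩
        k C 2 ∸ 1                             ≡⟨ *-identityˡ (k C 2 ∸ 1) ⟨
        1 * (k C 2 ∸ 1)                       ∎
        where
        open ≤-Reasoning
        PairOfK : Subset t → Bool
        PairOfK s = (s ⊆ᵇ K) ∧ IsPair s
        #PairOfK : # PairOfK ≡ k C 2
        #PairOfK = trans (count-subsets t K 2) (cong (_C 2) (≡ᵇ⇒≡-true ∣ K ∣ k (∧-elimʳ {e₀ ⊆ᵇ K} (∧-elimˡ joinEdge))))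
        e₀-counted : 1 ≤ # (λ s → PairOfK s ∧ (s ==ˢ e₀))
        e₀-counted = count-pos (subsets t) _ e₀ (∈-subsets t e₀)
          (∧-intro (∧-intro (∧-elimˡ (∧-elimˡ joinEdge)) (≡⇒≡ᵇ-true ∣ e₀ ∣ 2 e₀-pair)) (==ˢ-refl e₀))
        other-pair : ∀ s → Incident K s ≡ true → (PairOfK s ∧ not (s ==ˢ e₀)) ≡ true
        other-pair s incident = ∧-intro (∧-intro (∧-elimˡ s,e₀⊆K) (≡⇒≡ᵇ-true ∣ s ∣ 2 (S-pairs s Ss))) (not-intro s≢e₀)
          where
          Ss : S s ≡ true
          Ss = ∧-elimˡ {S s} incident
          s,e₀⊆K : ((s ⊆ᵇ K) ∧ (e₀ ⊆ᵇ K)) ≡ true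
          s,e₀⊆K = trans (sym (∪-⊆ᵇ s e₀ K)) (∧-elimˡ (∧-elimʳ {S s} incident))
          s≢e₀ : (s ==ˢ e₀) ≡ false
          s≢e₀ with s ==ˢ e₀ in s==e₀
          ... | false = refl
          ... | true = ⊥-elim (≡true⇒≢false (subst (λ z → S z ≡ true) (==ˢ-sound s e₀ s==e₀) Ss) Se₀)

      double-count : # S * (t′ C k′) ≤ # (JoinEdge e₀ S) * (k C 2 ∸ 1)
      double-count = begin
        # S * (t′ C k′)                       ≤⟨ count*≤∑ (subsets t) S _ (t′ C k′) edges-per-pair ⟩
        incidences                            ≡⟨ ∑-comm (subsets t) (subsets t) (λ s K → boolToℕ (Incident K s)) ⟩
        ∑ (subsets t) (λ K → # (Incident K))  ≤⟨ ∑≤count* (subsets t) (JoinEdge e₀ S) _ _ pairs-per-edge ⟩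
        # (JoinEdge e₀ S) * (k C 2 ∸ 1)       ∎
        where open ≤-Reasoning

    twice-count≤count-joinEdge : BergeRamseyCondition t′ k′ → 2 * # S ≤ # (JoinEdge e₀ S)
    twice-count≤count-joinEdge (room₄ , room₂) with S e₀ in Se₀
    ... | true = when-e₀∈S room₂ Se₀
    ... | false = *-cancelʳ-≤ _ _ (k C 2 ∸ 1) {{>-nonZero 1≤kC2∸1}} (begin
      2 * # S * (k C 2 ∸ 1)            ≡⟨ cong (_* (k C 2 ∸ 1)) (*-comm 2 (# S)) ⟩
      # S * 2 * (k C 2 ∸ 1)            ≡⟨ *-assoc (# S) 2 _ ⟩
      # S * (2 * (k C 2 ∸ 1))          ≤⟨ *-monoʳ-≤ (# S) room₄ ⟩
      # S * (t′ C k′)                  ≤⟨ WhenE₀∉S.double-count Se₀ ⟩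
      # (JoinEdge e₀ S) * (k C 2 ∸ 1)  ∎)
      where
      open ≤-Reasoning
      1≤kC2∸1 : 1 ≤ k C 2 ∸ 1
      1≤kC2∸1 = ≤-trans (s≤s z≤n) (∸-monoˡ-≤ 1 (C-monoˡ-≤ 2 {4} {k} (m≤m+n 4 k′)))

  _==ᵇ_ : Bool → Bool → Bool
  true ==ᵇ b = b
  false ==ᵇ b = not b

  ==ᵇ-sound : ∀ a b → a ==ᵇ b ≡ true → a ≡ b
  ==ᵇ-sound true true _ = refl
  ==ᵇ-sound false false _ = refl

  ==ᵇ-or-==ᵇ-not : ∀ a b → a ==ᵇ b ≡ true ⊎ a ==ᵇ not b ≡ true
  ==ᵇ-or-==ᵇ-not true true = inj₁ refl
  ==ᵇ-or-==ᵇ-not true false = inj₂ refl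
  ==ᵇ-or-==ᵇ-not false true = inj₂ refl
  ==ᵇ-or-==ᵇ-not false false = inj₁ refl

  Everything : Subset t → Bool
  Everything _ = true

  Contains : Colouring t → Bool → Subset t → Subset t → Bool
  Contains c col s K = EdgeThrough s K ∧ (c K ==ᵇ col)

  module Pairs⇔Edges (c : Colouring t) (col : Bool) =
    Hall (subsets t) _==ˢ_ ==ˢ-sound ==ˢ-refl (∈-subsets t) (count-==ˢ-≤1 t) (Contains c col)

  open Pairs⇔Edges using (Matching; neighbours)

  bergeKt : (c : Colouring t) (col : Bool) → Matching c col IsPair Everything → BergeKt k t t c col
  bergeKt c col M = (λ x → x) , (λ x≡y → x≡y) , ψ , ψ-edge , ψ-injective
    where
    open Pairs⇔Edges.Matching c col M
    isPair : ∀ u v → u <ᶠ v → IsPair (pair u v) ≡ true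
    isPair u v u<v = ≡⇒≡ᵇ-true _ 2 (∣pair∣≡2 u v (<ᶠ⇒≢ u<v))
    ψ : (u v : Fin t) → u <ᶠ v → Subset t
    ψ u v u<v = partner (pair u v) (isPair u v u<v)
    ψ-edge : ∀ u v (u<v : u <ᶠ v) → ∣ ψ u v u<v ∣ ≡ k × c (ψ u v u<v) ≡ col × u ∈ ψ u v u<v × v ∈ ψ u v u<v
    ψ-edge u v u<v = ≡ᵇ⇒≡-true _ k (∧-elimʳ {pair u v ⊆ᵇ ψ u v u<v} (∧-elimˡ contains))
                   , ==ᵇ-sound _ col (∧-elimʳ {EdgeThrough (pair u v) (ψ u v u<v)} contains)
                   , pair⊆ψ (u∈pair u v) , pair⊆ψ (v∈pair u v)
      where
      contains : Contains c col (pair u v) (ψ u v u<v) ≡ true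
      contains = partner-adj (pair u v) (isPair u v u<v)
      pair⊆ψ : pair u v ⊆ ψ u v u<v
      pair⊆ψ = ⊆ᵇ⇒⊆ (pair u v) (ψ u v u<v) (∧-elimˡ (∧-elimˡ contains))
    ψ-injective : ∀ u v (u<v : u <ᶠ v) u′ v′ (u′<v′ : u′ <ᶠ v′) → ψ u v u<v ≡ ψ u′ v′ u′<v′ → u ≡ u′ × v ≡ v′
    ψ-injective u v u<v u′ v′ u′<v′ same = pair-injective u<v u′<v′ (partner-injective _ _ _ _ same)

  joinEdge-neighbour : ∀ c col S T e₀ → T e₀ ≡ true → ∀ K → JoinEdge e₀ S K ≡ true →
    (neighbours c col Everything S K ∨ neighbours c (not col) Everything T K) ≡ true
  joinEdge-neighbour c col S T e₀ Te₀ K joinEdge with ==ᵇ-or-==ᵇ-not (c K) col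
  ... | inj₁ colour = ∨-introˡ (any-mono (subsets t) _ _ contains-col (∧-elimʳ {EdgeThrough e₀ K} joinEdge))
    where
    contains-col : ∀ s → (S s ∧ (s ⊆ᵇ K)) ≡ true → (S s ∧ Contains c col s K) ≡ true
    contains-col s Ss∧s⊆K = ∧-intro {S s} (∧-elimˡ Ss∧s⊆K) (∧-intro (∧-intro (∧-elimʳ {S s} Ss∧s⊆K) (∧-elimʳ {e₀ ⊆ᵇ K} (∧-elimˡ joinEdge))) colour)
  ... | inj₂ colour = ∨-introʳ (any-intro (subsets t) _ e₀ (∈-subsets t e₀) (∧-intro Te₀ (∧-intro (∧-elimˡ joinEdge) colour)))

  module _ (room : BergeRamseyCondition t′ k′) where

    not-both-deficient : ∀ c col S T → (∀ s → S s ≡ true → IsPair s ≡ true) → (∀ s → T s ≡ true → IsPair s ≡ true) →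
      # (neighbours c col Everything S) < # S →
      # (neighbours c (not col) Everything T) < # T →
      # T ≤ # S → ⊥
    not-both-deficient c col S T S-pairs T-pairs S-deficient T-deficient #T≤#S = <-irrefl refl (begin-strict
      2 * # S                                                                            ≤⟨ twice-count≤count-joinEdge room ⟩
      # JoinEdge e₀ S                                                                    ≤⟨ count-mono (subsets t) _ _ (joinEdge-neighbour c col S T e₀ Te₀) ⟩
      # (λ K → neighbours c col Everything S K ∨ neighbours c (not col) Everything T K)  ≤⟨ count-∨ (subsets t) _ _ ⟩
      # neighbours c col Everything S + # neighbours c (not col) Everything T            <⟨ +-mono-< S-deficient T-deficient ⟩
      # S + # T                                                                          ≤⟨ +-monoʳ-≤ (# S) #T≤#S ⟩
      # S + # S                                                                          ≡⟨ cong (# S +_) (+-identityʳ (# S)) ⟨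
      2 * # S                                                                            ∎)
      where
      open ≤-Reasoning
      T-nonempty : Σ (Subset t) λ e₀ → e₀ ∈ˡ subsets t × T e₀ ≡ true
      T-nonempty = count-witness (subsets t) T (≤-<-trans z≤n T-deficient)
      e₀ : Subset t
      e₀ = proj₁ T-nonempty
      Te₀ : T e₀ ≡ true
      Te₀ = proj₂ (proj₂ T-nonempty)
      open JoinEdgeBound e₀ (≡ᵇ⇒≡-true _ 2 (T-pairs e₀ Te₀)) S (λ s Ss → ≡ᵇ⇒≡-true _ 2 (S-pairs s Ss))

    arrows : RamseyArrows k t t
    arrows c with Pairs⇔Edges.matching-or-deficient c true IsPair Everything
                | Pairs⇔Edges.matching-or-deficient c false IsPair Everything
    ... | inj₁ M | _ = inj₁ (bergeKt c true M)
    ... | inj₂ _ | inj₁ M = inj₂ (bergeKt c false M)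
    ... | inj₂ (S , S-pairs , S-deficient) | inj₂ (T , T-pairs , T-deficient) with ≤-total (# T) (# S)
    ... | inj₁ #T≤#S = ⊥-elim (not-both-deficient c true S T S-pairs T-pairs S-deficient T-deficient #T≤#S)
    ... | inj₂ #S≤#T = ⊥-elim (not-both-deficient c false T S T-pairs S-pairs T-deficient S-deficient #S≤#T)

berge-ramsey-diagonal : ∀ t′ k′ → BergeRamseyCondition t′ k′ → RamseyBergeEq (4 + k′) (4 + t′) (4 + t′)
berge-ramsey-diagonal t′ k′ room = CompleteHypergraph.arrows t′ k′ room , not-arrows-below (4 + k′) (4 + t′)

-- The numerical conditions

2*[23+d]≤[21+d]C2 : ∀ d → 2 * (23 + d) ≤ (21 + d) C 2
2*[23+d]≤[21+d]C2 = ≤-by-increments (λ d → 2 * (23 + d)) (λ d → (21 + d) C 2) (λ _ → 2) (21 +_)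
  (≤ᵇ⇒≤ 46 210 tt) double-suc (λ d → C2-suc (21 + d)) (λ d → m≤m+n 2 (19 + d))
  where
  double-suc : ∀ d → 2 * (24 + d) ≡ 2 + 2 * (23 + d)
  double-suc = solve-∀

2*[23+d]C2≤[21+d]C3 : ∀ d → 2 * ((23 + d) C 2) ≤ (21 + d) C 3
2*[23+d]C2≤[21+d]C3 = ≤-by-increments (λ d → 2 * ((23 + d) C 2)) (λ d → (21 + d) C 3) (λ d → 2 * (23 + d)) (λ d → (21 + d) C 2)
  (≤ᵇ⇒≤ 506 1330 tt) (λ d → 2*C2-suc (23 + d)) (λ d → C-pascal (21 + d) 2) 2*[23+d]≤[21+d]C2

8*[20+e]+2≤[23+e]C2 : ∀ e → 8 * (20 + e) + 2 ≤ (23 + e) C 2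
8*[20+e]+2≤[23+e]C2 = ≤-by-increments (λ e → 8 * (20 + e) + 2) (λ e → (23 + e) C 2) (λ _ → 8) (23 +_)
  (≤ᵇ⇒≤ 162 253 tt) eight-suc (λ e → C2-suc (23 + e)) (λ e → m≤m+n 8 (15 + e))
  where
  eight-suc : ∀ e → 8 * (21 + e) + 2 ≡ 8 + (8 * (20 + e) + 2)
  eight-suc = solve-∀

2*[D+D]C2≤[3+D]C3 : ∀ e → let D = 20 + e in 2 * ((D + D) C 2) ≤ (3 + D) C 3
2*[D+D]C2≤[3+D]C3 = ≤-by-increments (λ e → 2 * (X e C 2)) (λ e → (23 + e) C 3) (λ e → 8 * (20 + e) + 2) (λ e → (23 + e) C 2)
  (≤ᵇ⇒≤ 1560 1771 tt) step (λ e → C-pascal (23 + e) 2) 8*[20+e]+2≤[23+e]C2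
  where
  X : ℕ → ℕ
  X e = (20 + e) + (20 + e)
  X-suc : ∀ e → (21 + e) + (21 + e) ≡ 2 + ((20 + e) + (20 + e))
  X-suc = solve-∀
  linear : ∀ e → 2 * suc ((20 + e) + (20 + e)) + 2 * ((20 + e) + (20 + e)) ≡ 8 * (20 + e) + 2
  linear = solve-∀
  step : ∀ e → 2 * (X (suc e) C 2) ≡ (8 * (20 + e) + 2) + 2 * (X e C 2)
  step e = begin
    2 * (X (suc e) C 2)                        ≡⟨ cong (λ n → 2 * (n C 2)) (X-suc e) ⟩
    2 * ((2 + X e) C 2)                        ≡⟨ 2*C2-suc (suc (X e)) ⟩
    2 * suc (X e) + 2 * (suc (X e) C 2)        ≡⟨ cong (2 * suc (X e) +_) (2*C2-suc (X e)) ⟩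
    2 * suc (X e) + (2 * X e + 2 * (X e C 2))  ≡⟨ +-assoc (2 * suc (X e)) _ _ ⟨
    (2 * suc (X e) + 2 * X e) + 2 * (X e C 2)  ≡⟨ cong (_+ 2 * (X e C 2)) (linear e) ⟩
    (8 * (20 + e) + 2) + 2 * (X e C 2)         ∎
    where open ≡-Reasoning

condition-k5 : ∀ d → BergeRamseyCondition (19 + d) 1
condition-k5 d = subst (18 ≤_) (sym (nC1≡n (19 + d))) (m≤m+n 18 (suc d)) , 2*[23+d]C2≤[21+d]C3 d

condition-large : ∀ j e → (5 + j) * (5 + j) ≤ e → BergeRamseyCondition (suc j + (20 + e)) (suc j)
condition-large j e k²≤e = room₄ , room₂
  where
  open ≤-Reasoning
  k D : ℕ
  k = 5 + j
  D = 20 + e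
  k²≤D : k * k ≤ D
  k²≤D = ≤-trans k²≤e (m≤n+m e 20)
  room₄ : 2 * (k C 2 ∸ 1) ≤ (suc j + D) C (suc j)
  room₄ = begin
    2 * (k C 2 ∸ 1)        ≤⟨ *-monoʳ-≤ 2 (m∸n≤m (k C 2) 1) ⟩
    2 * (k C 2)            ≤⟨ 2*nC2≤n*n k ⟩
    k * k                  ≤⟨ k²≤D ⟩
    D                      ≤⟨ n≤1+n D ⟩
    suc D                  ≡⟨ nC1≡n (suc D) ⟨
    suc D C 1              ≤⟨ C-shift j (suc D) 1 ⟩
    (j + suc D) C (j + 1)  ≡⟨ cong₂ _C_ (+-suc j D) (+-comm j 1) ⟩
    (suc j + D) C (suc j)  ∎
  room₂ : 2 * ((4 + (suc j + D)) C 2) ≤ (2 + (suc j + D)) C (2 + suc j)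
  room₂ = begin
    2 * ((k + D) C 2)        ≤⟨ *-monoʳ-≤ 2 (C-monoˡ-≤ 2 (+-monoˡ-≤ D (≤-trans (m≤m*n k k) k²≤D))) ⟩
    2 * ((D + D) C 2)        ≤⟨ 2*[D+D]C2≤[3+D]C3 e ⟩
    (3 + D) C 3              ≤⟨ C-shift j (3 + D) 3 ⟩
    (j + (3 + D)) C (j + 3)  ≡⟨ cong₂ _C_ (shift j D) (+-comm j 3) ⟩
    (3 + (j + D)) C (3 + j)  ∎
    where
    shift : ∀ j D → j + (3 + D) ≡ 3 + (j + D)
    shift = solve-∀

from-offset : ∀ t₀ (P : ℕ → Set) → (∀ d → P (t₀ + d)) → ∀ t → t ≥ t₀ → P t
from-offset t₀ P P-offset t t≥t₀ = subst P (m+[n∸m]≡n t≥t₀) (P-offset (t ∸ t₀))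

threshold : ℕ → ℕ
threshold j = (5 + j) + (20 + (5 + j) * (5 + j))

berge-ramsey-large : ∀ j t → t ≥ threshold j → RamseyBergeEq (5 + j) t t
berge-ramsey-large j = from-offset (threshold j) (λ t → RamseyBergeEq (5 + j) t t) λ d →
  subst (λ t → RamseyBergeEq (5 + j) t t) (shape j d)
    (berge-ramsey-diagonal (suc j + (20 + ((5 + j) * (5 + j) + d))) (suc j) (condition-large j _ (m≤m+n _ d)))
  where
  shape : ∀ j d → (5 + j) + (20 + ((5 + j) * (5 + j) + d)) ≡ ((5 + j) + (20 + (5 + j) * (5 + j))) + d
  shape = solve-∀

berge-ramsey-5 : ∀ t → t ≥ 23 → RamseyBergeEq 5 t t
berge-ramsey-5 = from-offset 23 (λ t → RamseyBergeEq 5 t t) λ d → berge-ramsey-diagonal (19 + d) 1 (condition-k5 d)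

theorem1p7 : ((k : ℕ) → k ≥ 5 → Σ ℕ λ t₀ → (t : ℕ) → t ≥ t₀ → RamseyBergeEq k t t)
    × ((t : ℕ) → t ≥ 23 → RamseyBergeEq 5 t t)
theorem1p7 = large-k , berge-ramsey-5
  where
  large-k : (k : ℕ) → k ≥ 5 → Σ ℕ λ t₀ → (t : ℕ) → t ≥ t₀ → RamseyBergeEq k t t
  large-k _ (s≤s (s≤s (s≤s (s≤s (s≤s {n = j} _))))) = threshold j , berge-ramsey-large j
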